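{- Let $k\ge 2$, let $G=(V,E)$ be a finite simple graph, and let $W$ be a face of $\Delta^t_k(G)$. Then $\Delta^t_k(G\setminus W) = \mathrm{lk}_{\Delta^t_k(G)} W$.
   Context: For $k\ge 1$, $\Delta_k^t(G)$ is the simplicial complex on $V$ whose facets are the complements $V\setminus S$ of independent sets $S$ of size $k$ in $G$. $G\setminus W$ is the induced subgraph on $V\setminus W$. The link of a face $\sigma$ in $\Delta$ is $\mathrm{lk}_\Delta\sigma=\{\tau\in\Delta:\sigma\cap\tau=\emptyset,\ \sigma\cup\tau\in\Delta\}$. -}

module Defs where

open import Data.Nat using (ℕ)
open import Data.Fin using (Fin; zero; suc)
open import Data.Fin.Subset using (Subset; Side; inside; outside; _∈_; _∉_; _⊆_; _∪_; _─_; ∣_∣)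
open import Data.Vec using (_∷_)
open import Data.Vec.Relation.Unary.Any using (here; there)
open import Data.Vec.Membership.Propositional using () 
open import Data.Vec.Base using ()
open import Data.Vec.Relation.Binary.Pointwise.Inductive using ()
open import Data.Product using (_×_; _,_; ∃-syntax)
open import Relation.Nullary using (¬_)
open import Relation.Binary.PropositionalEquality using (_≡_)
open import Data.Empty using (⊥-elim)
open import Data.Vec using (_[_]=_)
open _[_]=_

record Graph (n : ℕ) : Set₁ where
  field
    verts     : Subset n
    Adj       : Fin n → Fin n → Set
    sym       : ∀ {u v} → Adj u v → Adj v u
    irrefl    : ∀ {v} → ¬ Adj v v
    adj-verts : ∀ {u v} → Adj u v → (u ∈ verts) × (v ∈ verts)
open Graph public

∈─ : ∀ {n} (p q : Subset n) (x : Fin n) → x ∈ p → x ∉ q → x ∈ p ─ q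
∈─ (inside ∷ p) (outside ∷ q) zero here x∉q = here
∈─ (inside ∷ p) (inside ∷ q) zero here x∉q = ⊥-elim (x∉q here)
∈─ (s ∷ p) (outside ∷ q) (suc x) (there x∈p) x∉q = there (∈─ p q x x∈p λ h → x∉q (there h))
∈─ (s ∷ p) (inside ∷ q) (suc x) (there x∈p) x∉q = there (∈─ p q x x∈p λ h → x∉q (there h))

_∖_ : ∀ {n} → Graph n → Subset n → Graph n
G ∖ W = record
  { verts = verts G ─ W
  ; Adj = λ u v → Adj G u v × u ∉ W × v ∉ W
  ; sym = λ { (a , u∉ , v∉) → Graph.sym G a , v∉ , u∉ }
  ; irrefl = λ { (a , _ , _) → Graph.irrefl G a }
  ; adj-verts = λ { {u} {v} (a , u∉ , v∉) →
      let (u∈ , v∈) = adj-verts G a in ∈─ (verts G) W u u∈ u∉ , ∈─ (verts G) W v v∈ v∉ }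
  }

Complex : ℕ → Set₁
Complex n = Subset n → Set

Independent : ∀ {n} → Graph n → Subset n → Set
Independent G S = S ⊆ verts G × (∀ {u v} → u ∈ S → v ∈ S → ¬ Adj G u v)

-- Δ^t_k(G): facets are V ∖ S for independent S with |S| = k;
-- faces are the subsets of facets.
Δt : ∀ {n} → ℕ → Graph n → Complex n
Δt k G σ = ∃[ S ] (Independent G S × ∣ S ∣ ≡ k × σ ⊆ verts G ─ S)

Disjoint : ∀ {n} → Subset n → Subset n → Set
Disjoint σ τ = ∀ {x} → x ∈ σ → x ∉ τ

lk : ∀ {n} → Complex n → Subset n → Complex n
lk Δ σ τ = Δ τ × Disjoint σ τ × Δ (σ ∪ τ)

_≋_ : ∀ {n} → Complex n → Complex n → Set
Δ ≋ Γ = ∀ τ → (Δ τ → Γ τ) × (Γ τ → Δ τ)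

{-# OPTIONS --safe #-}
module Submission where

-- Both sides are described by the same independent sets S: an independent
-- set of G ∖ W is exactly an independent set of G missing W, and since W ⊆ V
-- the conditions τ ⊆ (V ∖ W) ∖ S and "W ∩ τ = ∅, W ∪ τ ⊆ V ∖ S" are
-- equivalent once W ∩ S = ∅. Neither k ≥ 2 nor the size of S plays a role.

open import Defs
open import Data.Nat using (ℕ; _≥_)
open import Data.Fin using (Fin)
open import Data.Fin.Subset using (Subset; outside; inside; _∈_; _∉_; _⊆_; _∪_; _─_)
open import Data.Fin.Subset.Properties using (⊆-trans; p─q⊆p; x∈p∧x∉q⇒x∈p─q; x∈p∪q⁻; p⊆p∪q; q⊆p∪q)
open import Data.Product using (_,_)
open import Data.Sum using ([_,_])
open import Data.Vec using (_∷_; _[_]=_)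
open _[_]=_

private
  variable
    n : ℕ
    p q r σ : Subset n
    x : Fin n

x∈p─q⇒x∉q : x ∈ p ─ q → x ∉ q
x∈p─q⇒x∉q {p = _ ∷ _} {q = outside ∷ _} (there x∈p─q) (there x∈q) = x∈p─q⇒x∉q x∈p─q x∈q
x∈p─q⇒x∉q {p = _ ∷ _} {q = inside ∷ _}  (there x∈p─q) (there x∈q) = x∈p─q⇒x∉q x∈p─q x∈q

p⊆r∧q⊆r⇒p∪q⊆r : p ⊆ r → q ⊆ r → p ∪ q ⊆ r
p⊆r∧q⊆r⇒p∪q⊆r {p = p} {q = q} p⊆r q⊆r x∈p∪q = [ p⊆r , q⊆r ] (x∈p∪q⁻ p q x∈p∪q)

Disjoint-sym : Disjoint p q → Disjoint q p
Disjoint-sym p#q x∈q x∈p = p#q x∈p x∈q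

⊆─⁺ : σ ⊆ p → Disjoint σ q → σ ⊆ p ─ q
⊆─⁺ σ⊆p σ#q x∈σ = x∈p∧x∉q⇒x∈p─q (σ⊆p x∈σ) (σ#q x∈σ)

⊆─⁻ : σ ⊆ p ─ q → Disjoint σ q
⊆─⁻ σ⊆p─q x∈σ = x∈p─q⇒x∉q (σ⊆p─q x∈σ)

⊆──⁺ : σ ⊆ p ─ r → Disjoint σ q → σ ⊆ p ─ q ─ r
⊆──⁺ σ⊆p─r σ#q = ⊆─⁺ (⊆─⁺ (⊆-trans σ⊆p─r (p─q⊆p _ _)) σ#q) (⊆─⁻ σ⊆p─r)

⊆──⁻ : σ ⊆ p ─ q ─ r → σ ⊆ p ─ r
⊆──⁻ σ⊆p─q─r =
  ⊆─⁺ (⊆-trans σ⊆p─q─r (⊆-trans (p─q⊆p _ _) (p─q⊆p _ _))) (⊆─⁻ σ⊆p─q─r)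

module _ (G : Graph n) (W : Subset n) where

  Independent-∖⁺ : ∀ {S} → Independent G S → Disjoint S W → Independent (G ∖ W) S
  Independent-∖⁺ (S⊆V , indep) S#W =
    ⊆─⁺ S⊆V S#W , λ u∈S v∈S (uv , _) → indep u∈S v∈S uv

  Independent-∖⁻ : ∀ {S} → Independent (G ∖ W) S → Independent G S
  Independent-∖⁻ (S⊆V─W , indep) =
    ⊆-trans S⊆V─W (p─q⊆p _ _) ,
    λ u∈S v∈S uv → indep u∈S v∈S (uv , ⊆─⁻ S⊆V─W u∈S , ⊆─⁻ S⊆V─W v∈S)

Δt-face⊆verts : ∀ {k} (G : Graph n) → Δt k G σ → σ ⊆ verts G
Δt-face⊆verts G (S , _ , _ , σ⊆V─S) = ⊆-trans σ⊆V─S (p─q⊆p (verts G) S)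

lemma3p3 : ∀ {n : ℕ} (k : ℕ) → k ≥ 2 → (G : Graph n) (W : Subset n) → Δt k G W
    → Δt k (G ∖ W) ≋ lk (Δt k G) W
lemma3p3 k _ G W W∈Δ τ = to , from
  where
  to : Δt k (G ∖ W) τ → lk (Δt k G) W τ
  to (S , S-indep@(S⊆V─W , _) , ∣S∣≡k , τ⊆) =
    (S , S-indepG , ∣S∣≡k , ⊆──⁻ τ⊆) ,
    Disjoint-sym (⊆─⁻ (⊆-trans τ⊆ (p─q⊆p _ S))) ,
    (S , S-indepG , ∣S∣≡k , p⊆r∧q⊆r⇒p∪q⊆r W⊆V─S (⊆──⁻ τ⊆))
    where
    S-indepG : Independent G S
    S-indepG = Independent-∖⁻ G W S-indep
    W⊆V─S : W ⊆ verts G ─ S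
    W⊆V─S = ⊆─⁺ (Δt-face⊆verts G W∈Δ) (Disjoint-sym (⊆─⁻ S⊆V─W))

  from : lk (Δt k G) W τ → Δt k (G ∖ W) τ
  from (_ , W#τ , (S , S-indep , ∣S∣≡k , W∪τ⊆V─S)) =
    S , Independent-∖⁺ G W S-indep S#W , ∣S∣≡k , ⊆──⁺ τ⊆V─S (Disjoint-sym W#τ)
    where
    τ⊆V─S : τ ⊆ verts G ─ S
    τ⊆V─S = ⊆-trans (q⊆p∪q W τ) W∪τ⊆V─S
    S#W : Disjoint S W
    S#W = Disjoint-sym (⊆─⁻ (⊆-trans (p⊆p∪q τ) W∪τ⊆V─S))
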